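{- Let $a,b\in\mathbb{Z}$, $q\in\mathbb{Z}\setminus\{0\}$, and $w_n=w_n(a,b,q)$ given by $w_0=a$, $w_1=b$, $w_n=qw_{n-1}+w_{n-2}$. If $3\mid q$, then $(w_n)$ modulo $3^n$ is not residue complete (for any $n\ge1$). Suppose $\gcd(a^2+qab-b^2,3)=\gcd(q,3)=1$. If $q\equiv4,5\pmod 9$, then $(w_n)$ modulo $3^n$ is residue complete if and only if $n=1$. If $q\not\equiv 4,5\pmod 9$, then $(w_n)$ modulo $3^n$ is residue complete for all $n\ge1$.
   Context: A sequence is residue complete modulo $m$ if every residue class of $\mathbb{Z}_m$ occurs among its terms modulo $m$. -}

module Defs where

open import Data.Nat using (ℕ; zero; suc)
open import Data.Integer using (ℤ; +_; _+_; _-_; _*_)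
open import Data.Integer.Divisibility using (_∣_)
open import Data.Product using (∃-syntax)

w : ℤ → ℤ → ℤ → ℕ → ℤ
w a b q zero          = a
w a b q (suc zero)    = b
w a b q (suc (suc n)) = q * w a b q (suc n) + w a b q n

ResidueComplete : (ℕ → ℤ) → ℕ → Set
ResidueComplete s m = (r : ℤ) → ∃[ k ] ((+ m) ∣ (s k - r))

module Submission where

-- For every solution s of s (k + 2) = q s (k + 1) + s k we have s (k + t) = w₀₁ t · s (k + 1) + w₁₀ t · s k,
-- so t is a period of s modulo m as soon as w₀₁ t ≡ 0 and w₁₀ t ≡ 1 (mod m). This happens for t = 2, m = 3
-- when 3 ∣ q and for t = 8, m = 9 when q ≡ 4, 5 (mod 9); then s meets fewer than m residues modulo m.
-- When 3 ∤ q, t = 8 works modulo 3, and expanding (1 + X)³ - 1 for the difference operator X shows that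
-- 8·3^m is a period modulo 3^(m+1) whose increment is ≡ 3^m (s (k + 8) - s k) modulo 3^(m+2). So a residue
-- reached modulo 3^(m+1) at an index k with 9 ∤ s (k + 8) - s k is reached modulo 3^(m+2) at one of
-- k, k + 8·3^m, k + 2·8·3^m, again at such an index. A computation modulo 9 shows that when 3 ∤ q and
-- 3 ∤ a² + qab - b² every residue modulo 3 is reached, at such an index unless q ≡ 4, 5 (mod 9).

open import Defs

-- The development uses signed divisibility; the anonymous module keeps it apart from the unsigned
-- divisibility of the statement.
module _ where
  open import Data.Nat as ℕ using (ℕ; zero; suc; _≤_; _<_; z≤n; s≤s; NonZero)
  import Data.Nat.Properties as ℕP
  import Data.Nat.Divisibility as ℕ∣
  import Data.Nat.DivMod as ℕDivMod
  open import Data.Nat.Tactic.RingSolver as ℕRing using ()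
  open import Data.Integer using (ℤ; +_; _+_; _-_; _*_; -_; 0ℤ; 1ℤ; _^_; _%ℕ_; _/ℕ_)
  import Data.Integer as ℤ
  import Data.Integer.Properties as ℤP
  open import Data.Integer.DivMod using (a≡a%ℕn+[a/ℕn]*n; n%ℕd<d)
  open import Data.Integer.Divisibility.Signed
    using (_∣_; divides; quotient; _∣?_; ∣-reflexive; ∣-trans; ∣ᵤ⇒∣; ∣⇒∣ᵤ;
           ∣m∣n⇒∣m+n; ∣m∣n⇒∣m-n; ∣m⇒∣-m; ∣n⇒∣m*n; *-monoʳ-∣; *-monoˡ-∣)
  open import Data.Integer.Tactic.RingSolver using (solve-∀)
  open import Data.Integer.GCD using (gcd; gcd-greatest)
  open import Data.Fin as Fin using (Fin; toℕ; fromℕ<)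
  open import Data.Fin.Properties using (pigeonhole; toℕ-fromℕ<; toℕ<n)
  open import Data.Product using (∃; ∃₂; uncurry; _×_; _,_; proj₁; proj₂; map₂)
  open import Data.Sum as Sum using (_⊎_; fromInj₂)
  open import Data.Empty using (⊥)
  open import Function using (_∘_)
  open import Relation.Nullary using (¬_; Dec; contradiction)
  open import Relation.Nullary.Decidable using (toWitness; map′; _⊎-dec_; _×-dec_; _→-dec_; ¬?)
  open import Relation.Binary.Bundles using (Setoid)
  open import Relation.Binary.Structures using (IsEquivalence)
  open import Relation.Binary.PropositionalEquality
    using (_≡_; refl; sym; trans; cong; cong₂; subst; module ≡-Reasoning)
  import Relation.Binary.Reasoning.Setoid as SetoidReasoning

  -- Congruences of integers

  infix 4 _≡_mod_
  record _≡_mod_ (x y m : ℤ) : Set where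
    constructor ≡-mod
    field divides-difference : m ∣ x - y

  ≡-mod-reflexive : ∀ {m x y} → x ≡ y → x ≡ y mod m
  ≡-mod-reflexive {x = x} refl = ≡-mod (subst (_ ∣_) (sym (ℤP.+-inverseʳ x)) (divides 0ℤ refl))

  ≡-mod-refl : ∀ {m} x → x ≡ x mod m
  ≡-mod-refl x = ≡-mod-reflexive refl

  ≡-mod-sym : ∀ {m x y} → x ≡ y mod m → y ≡ x mod m
  ≡-mod-sym {x = x} {y} (≡-mod m∣x-y) = ≡-mod (subst (_ ∣_) (negate x y) (∣m⇒∣-m m∣x-y))
    where negate : ∀ x y → - (x - y) ≡ y - x
          negate = solve-∀

  ≡-mod-trans : ∀ {m x y z} → x ≡ y mod m → y ≡ z mod m → x ≡ z mod m
  ≡-mod-trans {x = x} {y} {z} (≡-mod d) (≡-mod e) = ≡-mod (subst (_ ∣_) (telescope x y z) (∣m∣n⇒∣m+n d e))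
    where telescope : ∀ x y z → (x - y) + (y - z) ≡ x - z
          telescope = solve-∀

  ≡-mod-isEquivalence : ∀ m → IsEquivalence (λ x y → x ≡ y mod m)
  ≡-mod-isEquivalence m = record
    { refl = ≡-mod-reflexive refl ; sym = ≡-mod-sym ; trans = ≡-mod-trans }

  ≡-mod-setoid : ℤ → Setoid _ _
  ≡-mod-setoid m = record { isEquivalence = ≡-mod-isEquivalence m }

  module ≡-mod-Reasoning (m : ℤ) = SetoidReasoning (≡-mod-setoid m)

  +-cong-mod : ∀ {m x y x′ y′} → x ≡ y mod m → x′ ≡ y′ mod m → x + x′ ≡ y + y′ mod m
  +-cong-mod {x = x} {y} {x′} {y′} (≡-mod d) (≡-mod e) =
    ≡-mod (subst (_ ∣_) (regroup x y x′ y′) (∣m∣n⇒∣m+n d e))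
    where regroup : ∀ x y x′ y′ → (x - y) + (x′ - y′) ≡ (x + x′) - (y + y′)
          regroup = solve-∀

  -‿cong-mod : ∀ {m x y x′ y′} → x ≡ y mod m → x′ ≡ y′ mod m → x - x′ ≡ y - y′ mod m
  -‿cong-mod {x = x} {y} {x′} {y′} (≡-mod d) (≡-mod e) =
    ≡-mod (subst (_ ∣_) (regroup x y x′ y′) (∣m∣n⇒∣m-n d e))
    where regroup : ∀ x y x′ y′ → (x - y) - (x′ - y′) ≡ (x - x′) - (y - y′)
          regroup = solve-∀

  *-cong-mod : ∀ {m x y x′ y′} → x ≡ y mod m → x′ ≡ y′ mod m → x * x′ ≡ y * y′ mod m
  *-cong-mod {x = x} {y} {x′} {y′} (≡-mod d) (≡-mod e) =
    ≡-mod (subst (_ ∣_) (regroup x y x′ y′) (∣m∣n⇒∣m+n (∣n⇒∣m*n x′ d) (∣n⇒∣m*n y e)))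
    where regroup : ∀ x y x′ y′ → x′ * (x - y) + y * (x′ - y′) ≡ x * x′ - y * y′
          regroup = solve-∀

  *-scale-mod : ∀ {m x y} c → x ≡ y mod m → c * x ≡ c * y mod c * m
  *-scale-mod {x = x} {y} c (≡-mod d) = ≡-mod (subst (_ ∣_) (distrib c x y) (*-monoʳ-∣ c d))
    where distrib : ∀ c x y → c * (x - y) ≡ c * x - c * y
          distrib = solve-∀

  ≡-mod-weaken : ∀ {m n x y} → m ∣ n → x ≡ y mod n → x ≡ y mod m
  ≡-mod-weaken m∣n (≡-mod d) = ≡-mod (∣-trans m∣n d)

  ∣-resp-≡-mod : ∀ {m x y} → x ≡ y mod m → m ∣ y → m ∣ x
  ∣-resp-≡-mod {x = x} {y} (≡-mod d) m∣y = subst (_ ∣_) (cancel x y) (∣m∣n⇒∣m+n d m∣y)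
    where cancel : ∀ x y → (x - y) + y ≡ x
          cancel = solve-∀

  1∣_ : ∀ x → 1ℤ ∣ x
  1∣ x = ∣ᵤ⇒∣ (ℕ∣.1∣ ℤ.∣ x ∣)

  ∣⇒≡0-mod : ∀ {m x} → m ∣ x → x ≡ 0ℤ mod m
  ∣⇒≡0-mod {x = x} m∣x = ≡-mod (subst (_ ∣_) (sym (ℤP.+-identityʳ x)) m∣x)

  ≡-mod-%ℕ : ∀ x n .{{_ : NonZero n}} → x ≡ + (x %ℕ n) mod + n
  ≡-mod-%ℕ x n = ≡-mod (divides (x /ℕ n)
    (trans (cong (_- + (x %ℕ n)) (a≡a%ℕn+[a/ℕn]*n x n)) (cancel (+ (x %ℕ n)) _)))
    where cancel : ∀ a b → a + b - a ≡ b
          cancel = solve-∀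

  residues-distinct : ∀ {M i j} → i < M → j < M → + i ≡ + j mod + M → i ≡ j
  residues-distinct {M} {i} {j} i<M j<M (≡-mod M∣i-j) =
    ℤ-injective (ℤP.i-j≡0⇒i≡j (+ i) (+ j) (ℤP.∣i∣≡0⇒i≡0 (small-multiple (∣⇒∣ᵤ M∣i-j) distance<M)))
    where
    ℤ-injective : ∀ {a b} → + a ≡ + b → a ≡ b
    ℤ-injective refl = refl
    distance<M : ℤ.∣ + i - + j ∣ < M
    distance<M = ℕP.≤-<-trans
      (subst (ℕ._≤ i ℕ.⊔ j) (cong ℤ.∣_∣ (sym (ℤP.m-n≡m⊖n i j))) (ℤP.∣m⊝n∣≤m⊔n i j))
                              (ℕP.⊔-lub i<M j<M)
    small-multiple : ∀ {d} → M ℕ∣.∣ d → d < M → d ≡ 0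
    small-multiple {zero} _ _ = refl
    small-multiple {suc _} M∣d d<M = contradiction M∣d (ℕ∣.>⇒∤ d<M)

  -- Solutions of the recurrence

  record Recurrent (q : ℤ) (s : ℕ → ℤ) : Set where
    field recurrence : ∀ k → s (suc (suc k)) ≡ q * s (suc k) + s k
  open Recurrent

  w-recurrent : ∀ a b q → Recurrent q (w a b q)
  w-recurrent a b q = record { recurrence = λ _ → refl }

  w-cong-mod : ∀ {m a b q a′ b′ q′} → a ≡ a′ mod m → b ≡ b′ mod m → q ≡ q′ mod m →
               ∀ k → w a b q k ≡ w a′ b′ q′ k mod m
  w-cong-mod a≡ b≡ q≡ zero          = a≡
  w-cong-mod a≡ b≡ q≡ (suc zero)    = b≡
  w-cong-mod a≡ b≡ q≡ (suc (suc k)) =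
    +-cong-mod (*-cong-mod q≡ (w-cong-mod a≡ b≡ q≡ (suc k))) (w-cong-mod a≡ b≡ q≡ k)

  w₀₁ w₁₀ : ℤ → ℕ → ℤ
  w₀₁ = w 0ℤ 1ℤ
  w₁₀ = w 1ℤ 0ℤ

  recurrent-shift : ∀ {q s} → Recurrent q s → ∀ n k → s (n ℕ.+ k) ≡ w₀₁ q n * s (suc k) + w₁₀ q n * s k
  recurrent-shift {s = s} _ zero k = initial (s (suc k)) (s k)
    where initial : ∀ x y → y ≡ 0ℤ * x + 1ℤ * y
          initial = solve-∀
  recurrent-shift {s = s} _ (suc zero) k = initial (s (suc k)) (s k)
    where initial : ∀ x y → x ≡ 1ℤ * x + 0ℤ * y
          initial = solve-∀
  recurrent-shift {q} {s} rec (suc (suc n)) k = begin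
    s (suc (suc n) ℕ.+ k)                                        ≡⟨ recurrence rec (n ℕ.+ k) ⟩
    q * s (suc n ℕ.+ k) + s (n ℕ.+ k)                            ≡⟨ cong₂ (λ x y → q * x + y)
                                                                      (recurrent-shift rec (suc n) k)
                                                                      (recurrent-shift rec n k) ⟩
    q * (U₁ * s (suc k) + V₁ * s k) + (U₀ * s (suc k) + V₀ * s k) ≡⟨ collect q U₁ U₀ V₁ V₀ (s (suc k)) (s k) ⟩
    (q * U₁ + U₀) * s (suc k) + (q * V₁ + V₀) * s k              ∎
    where
    open ≡-Reasoning
    U₁ = w₀₁ q (suc n)
    U₀ = w₀₁ q n
    V₁ = w₁₀ q (suc n)
    V₀ = w₁₀ q n
    collect : ∀ q U₁ U₀ V₁ V₀ x y →
              q * (U₁ * x + V₁ * y) + (U₀ * x + V₀ * y) ≡ (q * U₁ + U₀) * x + (q * V₁ + V₀) * y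
    collect = solve-∀

  Δ : ℕ → (ℕ → ℤ) → ℕ → ℤ
  Δ t s k = s (k ℕ.+ t) - s k

  Δ-recurrent : ∀ {q s} t → Recurrent q s → Recurrent q (Δ t s)
  Δ-recurrent {q} {s} t rec = record { recurrence = λ k → step k }
    where
    step : ∀ k → Δ t s (suc (suc k)) ≡ q * Δ t s (suc k) + Δ t s k
    step k rewrite recurrence rec (k ℕ.+ t) | recurrence rec k = linear q _ _ _ _
      where linear : ∀ q a b c d → q * a + b - (q * c + d) ≡ q * (a - c) + (b - d)
            linear = solve-∀

  record Period (m q : ℤ) (t : ℕ) : Set where
    constructor mkPeriod
    field
      divides-w₀₁   : m ∣ w₀₁ q t
      divides-w₁₀-1 : m ∣ w₁₀ q t - 1ℤ

  period? : ∀ m q t → Dec (Period m q t)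
  period? m q t = map′ (uncurry mkPeriod) (λ (mkPeriod d e) → d , e) ((m ∣? _) ×-dec (m ∣? _))

  Period-cong : ∀ {m q q′ t} → q ≡ q′ mod m → Period m q′ t → Period m q t
  Period-cong {m} {t = t} q≡q′ (mkPeriod m∣U m∣V-1) =
    mkPeriod (∣-resp-≡-mod (w-cong-mod (≡-mod-refl 0ℤ) (≡-mod-refl 1ℤ) q≡q′ t) m∣U)
             (∣-resp-≡-mod (-‿cong-mod (w-cong-mod (≡-mod-refl 1ℤ) (≡-mod-refl 0ℤ) q≡q′ t) (≡-mod-refl 1ℤ))
                           m∣V-1)

  Period⇒∣Δ : ∀ {m q s t d} → Recurrent q s → Period m q t → (∀ i → d ∣ s i) → ∀ k → m * d ∣ Δ t s k
  Period⇒∣Δ {m} {q} {s} {t} {d} rec (mkPeriod m∣U m∣V-1) d∣s k = subst (m * d ∣_) (sym Δ≡) divisible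
    where
    Δ≡ : Δ t s k ≡ w₀₁ q t * s (suc k) + (w₁₀ q t - 1ℤ) * s k
    Δ≡ = trans (cong (λ i → s i - s k) (ℕP.+-comm k t))
               (trans (cong (_- s k) (recurrent-shift rec t k)) (rearrange (w₀₁ q t) (w₁₀ q t) (s (suc k)) (s k)))
      where rearrange : ∀ U V x y → U * x + V * y - y ≡ U * x + (V - 1ℤ) * y
            rearrange = solve-∀
    divisible : m * d ∣ w₀₁ q t * s (suc k) + (w₁₀ q t - 1ℤ) * s k
    divisible = ∣m∣n⇒∣m+n (*-mono-∣ m∣U (d∣s (suc k))) (*-mono-∣ m∣V-1 (d∣s k))
      where *-mono-∣ : ∀ {a b x y} → a ∣ x → b ∣ y → a * b ∣ x * y
            *-mono-∣ {a} {b} {x} a∣x b∣y = ∣-trans (*-monoˡ-∣ b a∣x) (*-monoʳ-∣ x b∣y)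

  Period⇒periodic : ∀ {m q s t} → Recurrent q s → Period m q t → ∀ k → s (k ℕ.+ t) ≡ s k mod m
  Period⇒periodic {m} {s = s} rec t-period k =
    ≡-mod (subst (_∣ _) (ℤP.*-identityʳ m) (Period⇒∣Δ rec t-period (λ i → 1∣ s i) k))

  period-2-mod-3 : ∀ {q} → + 3 ∣ q → Period (+ 3) q 2
  period-2-mod-3 {q} 3∣q =
    mkPeriod (subst (+ 3 ∣_) (sym (U₂≡q q)) 3∣q) (subst (+ 3 ∣_) (sym (V₂-1≡0 q)) (divides 0ℤ refl))
    where U₂≡q : ∀ q → q * 1ℤ + 0ℤ ≡ q
          U₂≡q = solve-∀
          V₂-1≡0 : ∀ q → q * 0ℤ + 1ℤ - 1ℤ ≡ 0ℤ
          V₂-1≡0 = solve-∀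

  -- The finite tables are proved by evaluating a decision procedure; opaque stops the type checker from
  -- re-running that evaluation wherever a table is used.
  opaque
    period-8-mod-3-residues : ∀ {r} → r < 3 → ¬ (+ 3 ∣ + r) → Period (+ 3) (+ r) 8
    period-8-mod-3-residues =
      toWitness {a? = ℕP.allUpTo? (λ r → ¬? (+ 3 ∣? + r) →-dec period? (+ 3) (+ r) 8) 3} _

  period-8-mod-3 : ∀ {q} → ¬ (+ 3 ∣ q) → Period (+ 3) q 8
  period-8-mod-3 {q} 3∤q = Period-cong (≡-mod-%ℕ q 3)
    (period-8-mod-3-residues (n%ℕd<d q 3) (3∤q ∘ ∣-resp-≡-mod (≡-mod-%ℕ q 3)))

  Exceptional : ℤ → Set
  Exceptional q = (q %ℕ 9 ≡ 4) ⊎ (q %ℕ 9 ≡ 5)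

  opaque
    period-8-mod-9-residues : ∀ {r} → r < 9 → (r ≡ 4) ⊎ (r ≡ 5) → Period (+ 9) (+ r) 8
    period-8-mod-9-residues =
      toWitness {a? = ℕP.allUpTo? (λ r → ((r ℕP.≟ 4) ⊎-dec (r ℕP.≟ 5)) →-dec period? (+ 9) (+ r) 8) 9} _

  period-8-mod-9 : ∀ {q} → Exceptional q → Period (+ 9) q 8
  period-8-mod-9 {q} exceptional = Period-cong (≡-mod-%ℕ q 9) (period-8-mod-9-residues (n%ℕd<d q 9) exceptional)

  -- Periodic sequences and the pigeonhole principle

  periodic-+* : ∀ {s : ℕ → ℤ} {m p} → (∀ k → s (k ℕ.+ p) ≡ s k mod m) →
                ∀ n k → s (k ℕ.+ n ℕ.* p) ≡ s k mod m
  periodic-+* {s} periodic zero k = ≡-mod-reflexive (cong s (ℕP.+-identityʳ k))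
  periodic-+* {s} {p = p} periodic (suc n) k =
    ≡-mod-trans (≡-mod-reflexive (cong s (reassociate k n p)))
                (≡-mod-trans (periodic (k ℕ.+ n ℕ.* p)) (periodic-+* periodic n k))
    where reassociate : ∀ k n p → k ℕ.+ (p ℕ.+ n ℕ.* p) ≡ k ℕ.+ n ℕ.* p ℕ.+ p
          reassociate = ℕRing.solve-∀

  periodic-% : ∀ {s : ℕ → ℤ} {m p} .{{_ : NonZero p}} → (∀ k → s (k ℕ.+ p) ≡ s k mod m) →
               ∀ k → s k ≡ s (k ℕ.% p) mod m
  periodic-% {s} {p = p} periodic k =
    ≡-mod-trans (≡-mod-reflexive (cong s (ℕDivMod.m≡m%n+[m/n]*n k p))) (periodic-+* periodic (k ℕ./ p) (k ℕ.% p))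

  periodic⇒¬complete : ∀ {s : ℕ → ℤ} {M p} .{{_ : NonZero p}} →
                       (∀ k → s (k ℕ.+ p) ≡ s k mod + M) → p < M → ¬ ResidueComplete s M
  periodic⇒¬complete {s} {M} {p} periodic p<M complete = collision (pigeonhole p<M slot)
    where
    index : Fin M → ℕ
    index r = proj₁ (complete (+ toℕ r))
    hit : ∀ r → s (index r) ≡ + toℕ r mod + M
    hit r = ≡-mod (∣ᵤ⇒∣ (proj₂ (complete (+ toℕ r))))
    slot : Fin M → Fin p
    slot r = fromℕ< (ℕDivMod.m%n<n (index r) p)
    collision : ∃₂ (λ i j → i Fin.< j × slot i ≡ slot j) → ⊥
    collision (i , j , i<j , same-slot) = ℕP.<-irrefl (residues-distinct (toℕ<n i) (toℕ<n j) i≡j) i<j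
      where
      same-% : index i ℕ.% p ≡ index j ℕ.% p
      same-% = trans (sym (toℕ-fromℕ< _)) (trans (cong toℕ same-slot) (toℕ-fromℕ< _))
      i≡j : + toℕ i ≡ + toℕ j mod + M
      i≡j = begin
        + toℕ i               ≈⟨ ≡-mod-sym (hit i) ⟩
        s (index i)           ≈⟨ periodic-% periodic (index i) ⟩
        s (index i ℕ.% p)     ≡⟨ cong s same-% ⟩
        s (index j ℕ.% p)     ≈⟨ ≡-mod-sym (periodic-% periodic (index j)) ⟩
        s (index j)           ≈⟨ hit j ⟩
        + toℕ j               ∎
        where open ≡-mod-Reasoning (+ M)

  ResidueComplete-∣ : ∀ {s m n} → m ℕ∣.∣ n → ResidueComplete s n → ResidueComplete s m
  ResidueComplete-∣ m∣n complete r = map₂ (ℕ∣.∣-trans m∣n) (complete r)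

  -- Lifting modulo powers of 3

  ^-mono-∣ : ∀ i {m n} → m ≤ n → i ^ m ∣ i ^ n
  ^-mono-∣ i {m} m≤n with o , refl ← ℕP.m≤n⇒∃[o]m+o≡n m≤n =
    divides (i ^ o) (trans (ℤP.^-distribˡ-+-* i m o) (ℤP.*-comm (i ^ m) (i ^ o)))

  8·3^ : ℕ → ℕ
  8·3^ zero    = 8
  8·3^ (suc m) = 8·3^ m ℕ.+ 8·3^ m ℕ.+ 8·3^ m

  -- (1 + X)³ - 1 = X³ + 3 X² + 3 X for the difference operator X = Δ t.
  Δ-triple : ∀ t s k → Δ (t ℕ.+ t ℕ.+ t) s k ≡ Δ t (Δ t (Δ t s)) k + + 3 * Δ t (Δ t s) k + + 3 * Δ t s k
  Δ-triple t s k = trans (cong (λ i → s i - s k) (reassociate k t))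
                         (expand (s k) (s (k ℕ.+ t)) (s (k ℕ.+ t ℕ.+ t)) (s (k ℕ.+ t ℕ.+ t ℕ.+ t)))
    where
    reassociate : ∀ k t → k ℕ.+ (t ℕ.+ t ℕ.+ t) ≡ k ℕ.+ t ℕ.+ t ℕ.+ t
    reassociate = ℕRing.solve-∀
    expand : ∀ s₀ s₁ s₂ s₃ → s₃ - s₀ ≡ ((s₃ - s₂) - (s₂ - s₁) - ((s₂ - s₁) - (s₁ - s₀)))
                                        + + 3 * ((s₂ - s₁) - (s₁ - s₀)) + + 3 * (s₁ - s₀)
    expand = solve-∀

  ∣Δ-8·3^ : ∀ {q s} → ¬ (+ 3 ∣ q) → Recurrent q s → ∀ m {j} → (∀ i → (+ 3) ^ j ∣ s i) →
              ∀ k → (+ 3) ^ (suc m ℕ.+ j) ∣ Δ (8·3^ m) s k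
  ∣Δ-8·3^ 3∤q rec zero 3ʲ∣s = Period⇒∣Δ rec (period-8-mod-3 3∤q) 3ʲ∣s
  ∣Δ-8·3^ {s = s} 3∤q rec (suc m) {j} 3ʲ∣s k =
    subst (_ ∣_) (sym (Δ-triple t s k)) (∣m∣n⇒∣m+n (∣m∣n⇒∣m+n cubic quadratic) linear)
    where
    t = 8·3^ m
    e = suc m
    Δ¹ : ∀ i → (+ 3) ^ (e ℕ.+ j) ∣ Δ t s i
    Δ¹ = ∣Δ-8·3^ 3∤q rec m 3ʲ∣s
    Δ² : ∀ i → (+ 3) ^ (e ℕ.+ (e ℕ.+ j)) ∣ Δ t (Δ t s) i
    Δ² = ∣Δ-8·3^ 3∤q (Δ-recurrent t rec) m Δ¹
    Δ³ : ∀ i → (+ 3) ^ (e ℕ.+ (e ℕ.+ (e ℕ.+ j))) ∣ Δ t (Δ t (Δ t s)) i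
    Δ³ = ∣Δ-8·3^ 3∤q (Δ-recurrent t (Δ-recurrent t rec)) m Δ²
    linear : (+ 3) ^ (suc e ℕ.+ j) ∣ + 3 * Δ t s k
    linear = *-monoʳ-∣ (+ 3) (Δ¹ k)
    quadratic : (+ 3) ^ (suc e ℕ.+ j) ∣ + 3 * Δ t (Δ t s) k
    quadratic = *-monoʳ-∣ (+ 3) (∣-trans (^-mono-∣ (+ 3) (ℕP.m≤n+m (e ℕ.+ j) e)) (Δ² k))
    cubic : (+ 3) ^ (suc e ℕ.+ j) ∣ Δ t (Δ t (Δ t s)) k
    cubic = ∣-trans (^-mono-∣ (+ 3) {n = e ℕ.+ (e ℕ.+ (e ℕ.+ j))} (ℕP.+-mono-≤ (s≤s z≤n) (ℕP.m≤n+m (e ℕ.+ j) e)))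
                    (Δ³ k)

  Δ-8·3^-≡ : ∀ {q s} → ¬ (+ 3 ∣ q) → Recurrent q s → ∀ m k →
               Δ (8·3^ m) s k ≡ (+ 3) ^ m * Δ 8 s k mod (+ 3) ^ (2 ℕ.+ m)
  Δ-8·3^-≡ 3∤q rec zero k = ≡-mod-reflexive (sym (ℤP.*-identityˡ _))
  Δ-8·3^-≡ {s = s} 3∤q rec (suc m) k = begin
    Δ (t ℕ.+ t ℕ.+ t) s k                                        ≡⟨ Δ-triple t s k ⟩
    Δ t (Δ t (Δ t s)) k + + 3 * Δ t (Δ t s) k + + 3 * Δ t s k   ≈⟨ +-cong-mod (+-cong-mod (∣⇒≡0-mod cubic)
                                                                                         (∣⇒≡0-mod quadratic))
                                                                      (*-scale-mod (+ 3) (Δ-8·3^-≡ 3∤q rec m k)) ⟩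
    0ℤ + 0ℤ + + 3 * ((+ 3) ^ m * Δ 8 s k)                         ≡⟨ simplify ((+ 3) ^ m) (Δ 8 s k) ⟩
    (+ 3) ^ suc m * Δ 8 s k                                       ∎
    where
    open ≡-mod-Reasoning ((+ 3) ^ (3 ℕ.+ m))
    t = 8·3^ m
    Δ² = ∣Δ-8·3^ 3∤q (Δ-recurrent t rec) m (∣Δ-8·3^ 3∤q rec m (λ i → 1∣ s i))
    Δ³ = ∣Δ-8·3^ 3∤q (Δ-recurrent t (Δ-recurrent t rec)) m Δ²
    ≤-by : ∀ {a b} c → a ℕ.+ c ≡ b → a ≤ b
    ≤-by c refl = ℕP.m≤m+n _ c
    quadratic : (+ 3) ^ (3 ℕ.+ m) ∣ + 3 * Δ t (Δ t s) k
    quadratic = ∣-trans (^-mono-∣ (+ 3) (≤-by {3 ℕ.+ m} m (exponents m))) (*-monoʳ-∣ (+ 3) (Δ² k))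
      where exponents : ∀ m → 3 ℕ.+ m ℕ.+ m ≡ suc (suc m ℕ.+ (suc m ℕ.+ 0))
            exponents = ℕRing.solve-∀
    cubic : (+ 3) ^ (3 ℕ.+ m) ∣ Δ t (Δ t (Δ t s)) k
    cubic = ∣-trans (^-mono-∣ (+ 3) (≤-by {3 ℕ.+ m} (m ℕ.+ m) (exponents m))) (Δ³ k)
      where exponents : ∀ m → 3 ℕ.+ m ℕ.+ (m ℕ.+ m) ≡ suc m ℕ.+ (suc m ℕ.+ (suc m ℕ.+ 0))
            exponents = ℕRing.solve-∀
    simplify : ∀ p d → 0ℤ + 0ℤ + + 3 * (p * d) ≡ + 3 * p * d
    simplify = solve-∀

  record GoodIndex (s : ℕ → ℤ) (m : ℕ) (r : ℤ) (k : ℕ) : Set where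
    constructor good
    field
      approximates-r : (+ 3) ^ suc m ∣ s k - r
      9∤Δ8           : ¬ (+ 9 ∣ Δ 8 s k)

  opaque
    linear-mod-3-residues : ∀ {c} → c < 3 → ∀ {u} → u < 3 → ¬ (+ 3 ∣ + u) →
                            ∃ λ j → j < 3 × (+ 3 ∣ + c + + j * + u)
    linear-mod-3-residues = toWitness {a? = ℕP.allUpTo? (λ c → ℕP.allUpTo? (λ u →
      ¬? (+ 3 ∣? + u) →-dec ℕP.anyUpTo? (λ j → + 3 ∣? + c + + j * + u) 3) 3) 3} _

  solve-linear-mod-3 : ∀ {u} → ¬ (+ 3 ∣ u) → ∀ c → ∃ λ j → + 3 ∣ c + + j * u
  solve-linear-mod-3 {u} 3∤u c =
    let (j , _ , 3∣c′+ju′) =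
          linear-mod-3-residues (n%ℕd<d c 3) (n%ℕd<d u 3) (3∤u ∘ ∣-resp-≡-mod (≡-mod-%ℕ u 3))
    in j , ∣-resp-≡-mod (+-cong-mod (≡-mod-%ℕ c 3) (*-cong-mod (≡-mod-refl (+ j)) (≡-mod-%ℕ u 3))) 3∣c′+ju′

  lift-good-index : ∀ {q s} → ¬ (+ 3 ∣ q) → Recurrent q s →
                    ∀ {m r k} → GoodIndex s m r k → ∃ (GoodIndex s (suc m) r)
  lift-good-index {q} {s} 3∤q rec {m} {r} {k} (good (divides c s[k]-r≡) 9∤δk) =
    k ℕ.+ j ℕ.* t ,
    good (∣-resp-≡-mod (proj₁ (walk j)) 3ᵐ⁺²∣target) (9∤δk ∘ ∣-resp-≡-mod (≡-mod-sym (proj₂ (walk j))))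
    where
    t = 8·3^ m
    δ = Δ 8 s
    3∣δ : ∀ i → + 3 ∣ δ i
    3∣δ = ∣Δ-8·3^ 3∤q rec 0 {0} (λ i → 1∣ s i)
    u = quotient (3∣δ k)
    δk≡u*3 : δ k ≡ u * + 3
    δk≡u*3 = _∣_.equality (3∣δ k)
    3∤u : ¬ (+ 3 ∣ u)
    3∤u (divides v u≡v*3) =
      9∤δk (divides v (trans δk≡u*3 (trans (cong (_* + 3) u≡v*3) (ℤP.*-assoc v (+ 3) (+ 3)))))
    j = proj₁ (solve-linear-mod-3 3∤u c)
    3ᵐ⁺²∣target : (+ 3) ^ (2 ℕ.+ m) ∣ (+ 3) ^ suc m * (c + + j * u)
    3ᵐ⁺²∣target = ∣-trans (∣-reflexive (ℤP.*-comm (+ 3) ((+ 3) ^ suc m)))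
                          (*-monoʳ-∣ ((+ 3) ^ suc m) (proj₂ (solve-linear-mod-3 3∤u c)))
    δ-periodic : ∀ i → δ (i ℕ.+ t) ≡ δ i mod + 9
    δ-periodic i =
      ≡-mod (∣-trans (^-mono-∣ (+ 3) (s≤s (ℕP.m≤n+m 1 m))) (∣Δ-8·3^ 3∤q (Δ-recurrent 8 rec) m 3∣δ i))
    reassociate : ∀ k j t → k ℕ.+ (t ℕ.+ j ℕ.* t) ≡ k ℕ.+ j ℕ.* t ℕ.+ t
    reassociate = ℕRing.solve-∀
    walk : ∀ j → (s (k ℕ.+ j ℕ.* t) - r ≡ (+ 3) ^ suc m * (c + + j * u) mod (+ 3) ^ (2 ℕ.+ m))
               × (δ (k ℕ.+ j ℕ.* t) ≡ δ k mod + 9)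
    walk zero =
      ≡-mod-reflexive (trans (cong (λ i → s i - r) (ℕP.+-identityʳ k)) (trans s[k]-r≡ (start c ((+ 3) ^ suc m) u))) ,
      ≡-mod-reflexive (cong δ (ℕP.+-identityʳ k))
      where start : ∀ c p u → c * p ≡ p * (c + 0ℤ * u)
            start = solve-∀
    walk (suc j) = s-step , δ-step
      where
      i = k ℕ.+ j ℕ.* t
      s-step : s (k ℕ.+ suc j ℕ.* t) - r ≡ (+ 3) ^ suc m * (c + + suc j * u) mod (+ 3) ^ (2 ℕ.+ m)
      s-step = begin
        s (k ℕ.+ suc j ℕ.* t) - r
          ≡⟨ cong (λ n → s n - r) (reassociate k j t) ⟩
        s (i ℕ.+ t) - r
          ≡⟨ split (s (i ℕ.+ t)) (s i) r ⟩
        Δ t s i + (s i - r)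
          ≈⟨ +-cong-mod (Δ-8·3^-≡ 3∤q rec m i) (proj₁ (walk j)) ⟩
        (+ 3) ^ m * δ i + (+ 3) ^ suc m * (c + + j * u)
          ≈⟨ +-cong-mod (≡-mod-weaken (∣-reflexive 9*3ᵐ) (*-scale-mod ((+ 3) ^ m) (proj₂ (walk j))))
                        (≡-mod-refl ((+ 3) ^ suc m * (c + + j * u))) ⟩
        (+ 3) ^ m * δ k + (+ 3) ^ suc m * (c + + j * u)
          ≡⟨ cong (λ x → (+ 3) ^ m * x + (+ 3) ^ suc m * (c + + j * u)) δk≡u*3 ⟩
        (+ 3) ^ m * (u * + 3) + (+ 3) ^ suc m * (c + + j * u)
          ≡⟨ collect ((+ 3) ^ m) u c (+ j) ⟩
        (+ 3) ^ suc m * (c + (1ℤ + + j) * u)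
          ≡⟨ cong (λ x → (+ 3) ^ suc m * (c + x * u)) (sym (ℤP.pos-+ 1 j)) ⟩
        (+ 3) ^ suc m * (c + + suc j * u)
          ∎
        where
        open ≡-mod-Reasoning ((+ 3) ^ (2 ℕ.+ m))
        split : ∀ x y r → x - r ≡ (x - y) + (y - r)
        split = solve-∀
        9*3ᵐ : (+ 3) ^ (2 ℕ.+ m) ≡ (+ 3) ^ m * + 9
        9*3ᵐ = rearrange ((+ 3) ^ m)
          where rearrange : ∀ p → + 3 * (+ 3 * p) ≡ p * + 9
                rearrange = solve-∀
        collect : ∀ p u c j → p * (u * + 3) + + 3 * p * (c + j * u) ≡ + 3 * p * (c + (1ℤ + j) * u)
        collect = solve-∀
      δ-step : δ (k ℕ.+ suc j ℕ.* t) ≡ δ k mod + 9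
      δ-step = ≡-mod-trans (≡-mod-reflexive (cong δ (reassociate k j t)))
                           (≡-mod-trans (δ-periodic i) (proj₂ (walk j)))

  good-indices : ∀ {q s} → ¬ (+ 3 ∣ q) → Recurrent q s →
                 (∀ r → ∃ (GoodIndex s 0 r)) → ∀ m r → ∃ (GoodIndex s m r)
  good-indices 3∤q rec good₀ zero    r = good₀ r
  good-indices 3∤q rec good₀ (suc m) r = lift-good-index 3∤q rec (proj₂ (good-indices 3∤q rec good₀ m r))

  pos-^ : ∀ m n → + (m ℕ.^ n) ≡ (+ m) ^ n
  pos-^ m zero    = refl
  pos-^ m (suc n) = trans (ℤP.pos-* m (m ℕ.^ n)) (cong (+ m *_) (pos-^ m n))

  good-indices⇒complete : ∀ {s m} → (∀ r → ∃ (GoodIndex s m r)) → ResidueComplete s (3 ℕ.^ suc m)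
  good-indices⇒complete {s} {m} good-index r =
    let (k , good 3ᵐ⁺¹∣s[k]-r _) = good-index r
    in k , ∣⇒∣ᵤ (subst (_∣ s k - r) (sym (pos-^ 3 (suc m))) 3ᵐ⁺¹∣s[k]-r)

  -- The base case, by exhaustion modulo 9

  disc : ℤ → ℤ → ℤ → ℤ
  disc a b q = a * a + q * a * b - b * b

  disc-cong-mod : ∀ {m a b q a′ b′ q′} → a ≡ a′ mod m → b ≡ b′ mod m → q ≡ q′ mod m →
                  disc a b q ≡ disc a′ b′ q′ mod m
  disc-cong-mod a≡ b≡ q≡ =
    -‿cong-mod (+-cong-mod (*-cong-mod a≡ a≡) (*-cong-mod (*-cong-mod q≡ a≡) b≡)) (*-cong-mod b≡ b≡)

  exceptional? : ∀ q → Dec (Exceptional q)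
  exceptional? q = (q %ℕ 9 ℕP.≟ 4) ⊎-dec (q %ℕ 9 ℕP.≟ 5)

  BaseIndex : ℤ → ℤ → ℤ → ℤ → ℕ → Set
  BaseIndex a b q r k = (+ 3 ∣ w a b q k - r) × (Exceptional q ⊎ ¬ (+ 9 ∣ Δ 8 (w a b q) k))

  opaque
    base-index-residues : ∀ {a} → a < 9 → ∀ {b} → b < 9 → ∀ {q} → q < 9 → ∀ {r} → r < 3 →
                          ¬ (+ 3 ∣ + q) → ¬ (+ 3 ∣ disc (+ a) (+ b) (+ q)) →
                          ∃ λ k → k < 8 × BaseIndex (+ a) (+ b) (+ q) (+ r) k
    base-index-residues = toWitness {a? =
      ℕP.allUpTo? (λ a → ℕP.allUpTo? (λ b → ℕP.allUpTo? (λ q → ℕP.allUpTo? (λ r →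
      ¬? (+ 3 ∣? + q) →-dec ¬? (+ 3 ∣? disc (+ a) (+ b) (+ q)) →-dec ℕP.anyUpTo? (λ k →
        (+ 3 ∣? w (+ a) (+ b) (+ q) k - + r) ×-dec
        (exceptional? (+ q) ⊎-dec ¬? (+ 9 ∣? Δ 8 (w (+ a) (+ b) (+ q)) k))) 8) 3) 9) 9) 9} _

  base-index : ∀ {a b q} → ¬ (+ 3 ∣ q) → ¬ (+ 3 ∣ disc a b q) → ∀ r → ∃ (BaseIndex a b q r)
  base-index {a} {b} {q} 3∤q 3∤disc r =
    let (k , _ , index′) = base-index-residues (n%ℕd<d a 9) (n%ℕd<d b 9) (n%ℕd<d q 9) (n%ℕd<d r 3)
                                          (3∤q ∘ ∣-resp-≡-mod (mod-3 q≡q′))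
                                          (3∤disc ∘ ∣-resp-≡-mod (mod-3 (disc-cong-mod a≡a′ b≡b′ q≡q′)))
    in k , from-residues k index′
    where
    a′ = + (a %ℕ 9)
    b′ = + (b %ℕ 9)
    q′ = + (q %ℕ 9)
    r′ = + (r %ℕ 3)
    a≡a′ : a ≡ a′ mod + 9
    a≡a′ = ≡-mod-%ℕ a 9
    b≡b′ : b ≡ b′ mod + 9
    b≡b′ = ≡-mod-%ℕ b 9
    q≡q′ : q ≡ q′ mod + 9
    q≡q′ = ≡-mod-%ℕ q 9
    mod-3 : ∀ {x y} → x ≡ y mod + 9 → x ≡ y mod + 3
    mod-3 = ≡-mod-weaken (divides (+ 3) refl)
    w≡w′ : ∀ k → w a b q k ≡ w a′ b′ q′ k mod + 9
    w≡w′ = w-cong-mod a≡a′ b≡b′ q≡q′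
    from-residues : ∀ k → BaseIndex a′ b′ q′ r′ k → BaseIndex a b q r k
    from-residues k (3∣w′-r′ , exceptional′∨9∤Δ′) =
      ∣-resp-≡-mod w-r≡w′-r′ 3∣w′-r′ ,
      Sum.map exceptional-residue (λ 9∤Δ′ → 9∤Δ′ ∘ ∣-resp-≡-mod Δ′≡Δ) exceptional′∨9∤Δ′
      where
      w-r≡w′-r′ : w a b q k - r ≡ w a′ b′ q′ k - r′ mod + 3
      w-r≡w′-r′ = -‿cong-mod (mod-3 (w≡w′ k)) (≡-mod-%ℕ r 3)
      Δ′≡Δ : Δ 8 (w a′ b′ q′) k ≡ Δ 8 (w a b q) k mod + 9
      Δ′≡Δ = ≡-mod-sym (-‿cong-mod (w≡w′ (k ℕ.+ 8)) (w≡w′ k))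
      exceptional-residue : Exceptional q′ → Exceptional q
      exceptional-residue = subst (λ r → (r ≡ 4) ⊎ (r ≡ 5)) (ℕDivMod.m<n⇒m%n≡m (n%ℕd<d q 9))

  w-incomplete-3∣q : ∀ {a b q} → + 3 ∣ q → ∀ m → ¬ ResidueComplete (w a b q) (3 ℕ.^ suc m)
  w-incomplete-3∣q {a} {b} {q} 3∣q m =
    periodic⇒¬complete (Period⇒periodic (w-recurrent a b q) (period-2-mod-3 3∣q)) (ℕP.n<1+n 2)
    ∘ ResidueComplete-∣ {w a b q} (ℕ∣.m∣m*n {3} (3 ℕ.^ m))

  w-incomplete-exceptional : ∀ {a b q} → Exceptional q → ∀ m → ¬ ResidueComplete (w a b q) (3 ℕ.^ (2 ℕ.+ m))
  w-incomplete-exceptional {a} {b} {q} exceptional m =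
    periodic⇒¬complete (Period⇒periodic (w-recurrent a b q) (period-8-mod-9 exceptional)) (ℕP.n<1+n 8)
    ∘ ResidueComplete-∣ {w a b q} (ℕ∣.*-monoʳ-∣ 3 (ℕ∣.m∣m*n {3} (3 ℕ.^ m)))

  w-complete-mod-3 : ∀ {a b q} → ¬ (+ 3 ∣ q) → ¬ (+ 3 ∣ disc a b q) → ResidueComplete (w a b q) 3
  w-complete-mod-3 {a} {b} 3∤q 3∤disc r =
    let (k , 3∣w[k]-r , _) = base-index {a} {b} 3∤q 3∤disc r in k , ∣⇒∣ᵤ 3∣w[k]-r

  w-complete : ∀ {a b q} → ¬ Exceptional q → ¬ (+ 3 ∣ q) → ¬ (+ 3 ∣ disc a b q) →
               ∀ m → ResidueComplete (w a b q) (3 ℕ.^ suc m)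
  w-complete {a} {b} {q} ¬exceptional 3∤q 3∤disc m =
    good-indices⇒complete (good-indices 3∤q (w-recurrent a b q) good₀ m)
    where
    good₀ : ∀ r → ∃ (GoodIndex (w a b q) 0 r)
    good₀ r = let (k , 3∣w[k]-r , exceptional∨9∤Δ) = base-index {a} {b} 3∤q 3∤disc r
              in k , good 3∣w[k]-r (fromInj₂ (λ exceptional → contradiction exceptional ¬exceptional) exceptional∨9∤Δ)

  gcd≡1⇒3∤ : ∀ {x} → gcd x (+ 3) ≡ + 1 → ¬ (+ 3 ∣ x)
  gcd≡1⇒3∤ {x} gcd≡1 3∣x
    with () ← ℕ∣.∣1⇒≡1 (subst (λ g → 3 ℕ∣.∣ ℤ.∣ g ∣) gcd≡1 (gcd-greatest {x} {+ 3} {+ 3} (∣⇒∣ᵤ 3∣x) ℕ∣.∣-refl))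

open import Data.Nat using (ℕ; zero; suc; _≥_; _^_)
open import Data.Integer using (ℤ; +_; _+_; _-_; _*_; 0ℤ; _%ℕ_)
open import Data.Integer.Divisibility using (_∣_)
open import Data.Integer.Divisibility.Signed using (∣ᵤ⇒∣)
open import Data.Integer.GCD using (gcd)
open import Data.Product using (_×_; _,_)
open import Data.Sum using (_⊎_)
open import Relation.Nullary using (¬_; contradiction)
open import Relation.Binary.PropositionalEquality using (_≡_; _≢_; refl)
open import Function.Bundles using (_⇔_; mk⇔)

lemma4p2 : (a b q : ℤ) → q ≢ 0ℤ →
    ((+ 3) ∣ q → (n : ℕ) → n ≥ 1 → ¬ ResidueComplete (w a b q) (3 ^ n))
    × (gcd (a * a + q * a * b - b * b) (+ 3) ≡ + 1 → gcd q (+ 3) ≡ + 1 →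
        (((q %ℕ 9 ≡ 4) ⊎ (q %ℕ 9 ≡ 5)) →
          (n : ℕ) → n ≥ 1 → (ResidueComplete (w a b q) (3 ^ n) ⇔ n ≡ 1))
        × (¬ ((q %ℕ 9 ≡ 4) ⊎ (q %ℕ 9 ≡ 5)) →
          (n : ℕ) → n ≥ 1 → ResidueComplete (w a b q) (3 ^ n)))
lemma4p2 a b q _ = incomplete , λ disc-coprime q-coprime →
  let 3∤q    = gcd≡1⇒3∤ q-coprime
      3∤disc = gcd≡1⇒3∤ disc-coprime
  in (λ { exceptional (suc zero) _ → mk⇔ (λ _ → refl) (λ _ → w-complete-mod-3 3∤q 3∤disc)
        ; exceptional (suc (suc m)) _ →
            mk⇔ (λ complete → contradiction complete (w-incomplete-exceptional exceptional m)) λ () })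
   , (λ { ¬exceptional (suc m) _ → w-complete ¬exceptional 3∤q 3∤disc m })
  where
  incomplete : (+ 3) ∣ q → (n : ℕ) → n ≥ 1 → ¬ ResidueComplete (w a b q) (3 ^ n)
  incomplete 3∣q (suc m) _ = w-incomplete-3∣q (∣ᵤ⇒∣ 3∣q) m
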